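{- Let $G$ be a connected graph with no subgraph isomorphic to $Y$, and let $P=v_0v_1\dots v_\ell$ be a longest path in $G$, chosen subject to that to minimize $\deg(v_0)+\deg(v_\ell)$, with $\ell\ge5$. Let $L_i=N_G(v_i)\setminus V(P)$. Assume $G$ has no edge $v_av_b$ with $a\in\{0,1\}$, $b\in\{\ell-1,\ell\}$, and $L_1\cap L_{\ell-1}=\emptyset$. Then no $2$-chord of $P$ crosses a vee of $P$; that is, there is no $i$ with $v_{i-1}v_{i+1}\in E(G)$ and $L_i\cap L_{i+2}\ne\emptyset$ (for $1\le i\le\ell-2$), and no $i$ with $v_{i-1}v_{i+1}\in E(G)$ and $L_{i-2}\cap L_i\ne\emptyset$ (for $2\le i\le\ell-1$).
   Context: All graphs are finite and simple. $Y$ is the 7-vertex tree obtained from $K_{1,3}$ by subdividing each edge exactly once. A $2$-chord of $P$ is an edge $v_jv_{j+2}$. A vee is a path $v_jwv_{j+2}$ with $w\in L_j\cap L_{j+2}$; its enclosed vertex is $v_{j+1}$. A chord and a vee cross if the enclosed vertex of the vee is an endpoint of the chord. -}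

module Defs where

open import Data.Nat using (ℕ; zero; suc; _≤_; _<_; _∸_; _+_)
open import Data.Fin using (Fin; #_)
open import Data.List using (length; filter; allFin)
open import Data.Product using (Σ; _×_; ∃)
open import Relation.Nullary using (¬_; Dec)
open import Relation.Binary.PropositionalEquality using (_≡_; _≢_)

record Graph : Set₁ where
  field
    n     : ℕ
    E     : Fin n → Fin n → Set
    E?    : ∀ u w → Dec (E u w)
    sym   : ∀ {u w} → E u w → E w u
    irr   : ∀ {u} → ¬ E u u

open Graph public

deg : (G : Graph) → Fin (n G) → ℕ
deg G u = length (filter (E? G u) (allFin (n G)))

data Walk (G : Graph) : Fin (n G) → Fin (n G) → Set where
  here : ∀ {u} → Walk G u u
  step : ∀ {u w x} → E G u w → Walk G w x → Walk G u x

Connected : Graph → Set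
Connected G = ∀ u w → Walk G u w

-- The tree Y: centre 0, legs 0-1-2, 0-3-4, 0-5-6
-- (K_{1,3} with each edge subdivided once).
data YEdge : Fin 7 → Fin 7 → Set where
  e01 : YEdge (# 0) (# 1)
  e12 : YEdge (# 1) (# 2)
  e03 : YEdge (# 0) (# 3)
  e34 : YEdge (# 3) (# 4)
  e05 : YEdge (# 0) (# 5)
  e56 : YEdge (# 5) (# 6)

-- G has a (not necessarily induced) subgraph isomorphic to Y:
-- an injective map of V(Y) into V(G) sending edges to edges.
HasYSubgraph : Graph → Set
HasYSubgraph G =
  Σ (Fin 7 → Fin (n G)) λ f →
    (∀ a b → f a ≡ f b → a ≡ b) × (∀ a b → YEdge a b → E G (f a) (f b))

record Path (G : Graph) (ℓ : ℕ) : Set where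
  field
    v   : ℕ → Fin (n G)
    adj : ∀ i → i < ℓ → E G (v i) (v (suc i))
    inj : ∀ i j → i ≤ ℓ → j ≤ ℓ → v i ≡ v j → i ≡ j

open Path public

OnPath : ∀ {G ℓ} → Path G ℓ → Fin (n G) → Set
OnPath {ℓ = ℓ} P w = Σ ℕ λ k → k ≤ ℓ × v P k ≡ w

InL : ∀ {G ℓ} → Path G ℓ → ℕ → Fin (n G) → Set
InL {G} P i w = E G (v P i) w × ¬ OnPath P w

CommonL : ∀ {G ℓ} → Path G ℓ → ℕ → ℕ → Set
CommonL {G} P i j = Σ (Fin (n G)) λ w → InL P i w × InL P j w

Longest : ∀ {G ℓ} → Path G ℓ → Set
Longest {G} {ℓ} P = ∀ m → Path G m → m ≤ ℓ

EndDegMin : ∀ {G ℓ} → Path G ℓ → Set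
EndDegMin {G} {ℓ} P =
  ∀ (Q : Path G ℓ) → deg G (v P 0) + deg G (v P ℓ) ≤ deg G (v Q 0) + deg G (v Q ℓ)

-- A 2-chord that crosses a vee lets P be rerouted through the vertex w of the
-- vee.  For the chord v_{i-1}v_{i+1} and the vee v_i w v_{i+2} the segment
-- v_{i-1} v_i v_{i+1} v_{i+2} becomes v_{i-1} v_{i+1} v_i w v_{i+2}; for the
-- vee v_{i-2} w v_i the segment v_{i-2} v_{i-1} v_i v_{i+1} becomes
-- v_{i-2} w v_i v_{i-1} v_{i+1}.  Either way P grows by one edge, contradicting
-- its maximality, which is the only hypothesis on P that is needed.
module Submission where

open import Defs
open import Data.Nat using (ℕ; zero; suc; _≤_; _<_; _∸_; _+_; z≤n; s≤s; s≤s⁻¹; z<s; s<s)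
open import Data.Nat.Properties
open import Data.Fin using (Fin)
open import Data.Product using (_×_; _,_; proj₁; proj₂)
open import Data.Empty using (⊥-elim)
open import Function using (_∘_)
open import Relation.Nullary using (¬_)
open import Relation.Binary.PropositionalEquality
  using (_≡_; _≢_; refl; cong; subst) renaming (sym to ≡-sym; trans to ≡-trans)

module _ {X : Set} where

  infixr 5 _◂_

  _◂_ : X → (ℕ → X) → ℕ → X
  (x ◂ f) zero    = x
  (x ◂ f) (suc k) = f k

  splice : ℕ → (ℕ → X) → (ℕ → X) → ℕ → X
  splice zero    f g = g
  splice (suc p) f g = f 0 ◂ splice p (f ∘ suc) g

  AllBelow : ℕ → (X → Set) → (ℕ → X) → Set
  AllBelow n Q f = ∀ i → i < n → Q (f i)

  InjectiveBelow : ℕ → (ℕ → X) → Set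
  InjectiveBelow n f = ∀ i j → i < n → j < n → f i ≡ f j → i ≡ j

  Chain : (X → X → Set) → ℕ → (ℕ → X) → Set
  Chain R n f = ∀ i → i < n → R (f i) (f (suc i))

  ◂-all : ∀ {Q : X → Set} {n x f} → Q x → AllBelow n Q f → AllBelow (suc n) Q (x ◂ f)
  ◂-all Qx Qf zero    _         = Qx
  ◂-all Qx Qf (suc i) (s<s i<n) = Qf i i<n

  splice-all : ∀ {Q : X → Set} p {m f g} →
    AllBelow p Q f → AllBelow (suc m) Q g → AllBelow (suc (p + m)) Q (splice p f g)
  splice-all zero    Qf Qg = Qg
  splice-all {Q} (suc p) Qf Qg =
    ◂-all {Q = Q} (Qf 0 z<s) (splice-all {Q = Q} p (λ i i<p → Qf (suc i) (s<s i<p)) Qg)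

  ◂-injective : ∀ {n x f} → AllBelow n (x ≢_) f → InjectiveBelow n f →
    InjectiveBelow (suc n) (x ◂ f)
  ◂-injective fresh f-inj zero    zero    _         _         _  = refl
  ◂-injective fresh f-inj zero    (suc j) _         (s<s j<n) eq = ⊥-elim (fresh j j<n eq)
  ◂-injective fresh f-inj (suc i) zero    (s<s i<n) _         eq = ⊥-elim (fresh i i<n (≡-sym eq))
  ◂-injective fresh f-inj (suc i) (suc j) (s<s i<n) (s<s j<n) eq = cong suc (f-inj i j i<n j<n eq)

  splice-injective : ∀ p {m f g} → InjectiveBelow p f → InjectiveBelow (suc m) g →
    (∀ a → a < p → AllBelow (suc m) (f a ≢_) g) →
    InjectiveBelow (suc (p + m)) (splice p f g)
  splice-injective zero    f-inj g-inj apart = g-inj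
  splice-injective (suc p) {f = f} f-inj g-inj apart =
    ◂-injective (splice-all {Q = f 0 ≢_} p f₀-fresh (apart 0 z<s))
      (splice-injective p
        (λ i j i<p j<p eq → suc-injective (f-inj (suc i) (suc j) (s<s i<p) (s<s j<p) eq))
        g-inj (λ a a<p → apart (suc a) (s<s a<p)))
    where
    f₀-fresh : AllBelow p (f 0 ≢_) (f ∘ suc)
    f₀-fresh i i<p eq = 0≢1+n (f-inj 0 (suc i) z<s (s<s i<p) eq)

  injective-drop : ∀ k {n f} → InjectiveBelow (suc (k + n)) f →
    InjectiveBelow (suc n) (λ t → f (k + t))
  injective-drop k f-inj i j i<n j<n eq =
    +-cancelˡ-≡ k i j (f-inj (k + i) (k + j) (shift i<n) (shift j<n) eq)
    where
    shift : ∀ {t n} → t < suc n → k + t < suc (k + n)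
    shift t<n = s≤s (+-monoʳ-≤ k (s≤s⁻¹ t<n))

  ◂-chain : ∀ {R : X → X → Set} {n x f} → R x (f 0) → Chain R n f → Chain R (suc n) (x ◂ f)
  ◂-chain Rxf c zero    _         = Rxf
  ◂-chain Rxf c (suc i) (s<s i<n) = c i i<n

  splice-chain : ∀ {R : X → X → Set} p {m f g} →
    (∀ i → suc i < p → R (f i) (f (suc i))) → (∀ i → suc i ≡ p → R (f i) (g 0)) →
    Chain R m g → Chain R (p + m) (splice p f g)
  splice-chain zero    inner join cg = cg
  splice-chain {R} (suc p) {f = f} {g} inner join cg =
    ◂-chain {R = R} (first-edge p inner join)
      (splice-chain {R = R} p (λ i h → inner (suc i) (s<s h)) (λ i e → join (suc i) (cong suc e)) cg)
    where
    first-edge : ∀ p → (∀ i → suc i < suc p → R (f i) (f (suc i))) →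
      (∀ i → suc i ≡ suc p → R (f i) (g 0)) → R (f 0) (splice p (f ∘ suc) g 0)
    first-edge zero    inner join = join 0 refl
    first-edge (suc p) inner join = inner 0 (s<s z<s)

  chain-drop : ∀ {R : X → X → Set} k {n f} → Chain R (k + n) f →
    Chain R n (λ t → f (k + t))
  chain-drop zero    c = c
  chain-drop {R} (suc k) c = chain-drop {R = R} k (λ i i<n → c (suc i) (s<s i<n))

module _ {G : Graph} where

  path : ∀ {L f} → InjectiveBelow (suc L) f → Chain (E G) L f → Path G L
  path {f = f} f-inj f-chain = record
    { v = f ; adj = f-chain ; inj = λ i j i≤L j≤L → f-inj i j (s≤s i≤L) (s≤s j≤L) }

  path-injective : ∀ {ℓ} (P : Path G ℓ) → InjectiveBelow (suc ℓ) (v P)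
  path-injective P i j i<ℓ j<ℓ = inj P i j (s≤s⁻¹ i<ℓ) (s≤s⁻¹ j<ℓ)

  OffPathOutside : ∀ {ℓ} → Path G ℓ → ℕ → Fin (n G) → Set
  OffPathOutside {ℓ} P p x = ∀ a → a ≤ ℓ → v P a ≡ x → p ≤ a × a ≤ suc p

  offPath⇒offPathOutside : ∀ {ℓ p x} (P : Path G ℓ) → ¬ OnPath P x → OffPathOutside P p x
  offPath⇒offPathOutside P x∉P a a≤ℓ eq = ⊥-elim (x∉P (a , a≤ℓ , eq))

  segment⇒offPathOutside : ∀ {ℓ p j} (P : Path G ℓ) → p ≤ j → j ≤ suc p → j ≤ ℓ →
    OffPathOutside P p (v P j)
  segment⇒offPathOutside P p≤j j≤p+1 j≤ℓ a a≤ℓ eq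
    rewrite inj P a _ a≤ℓ j≤ℓ eq = p≤j , j≤p+1

  -- P with its segment v_p v_{p+1} replaced by the three vertices x₀ x₁ x₂.
  record Detour {ℓ} (P : Path G ℓ) (p : ℕ) : Set where
    field
      x₀ x₁ x₂ : Fin (n G)
      x₀-off : OffPathOutside P p x₀
      x₁-off : OffPathOutside P p x₁
      x₂-off : OffPathOutside P p x₂
      x₀≢x₁ : x₀ ≢ x₁
      x₀≢x₂ : x₀ ≢ x₂
      x₁≢x₂ : x₁ ≢ x₂
      enter : ∀ a → suc a ≡ p → E G (v P a) x₀
      x₀x₁ : E G x₀ x₁
      x₁x₂ : E G x₁ x₂
      leave : E G x₂ (v P (suc (suc p)))

  detour-path′ : ∀ {p m} (P : Path G (suc (suc p) + m)) → Detour P p → Path G (p + (3 + m))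
  detour-path′ {p} {m} P D =
    path (splice-injective p prefix-injective rerouted-injective prefix-apart)
      (splice-chain {R = E G} p (λ i i+1<p → adj P i (<-trans (n<1+n i) (<-≤-trans i+1<p p≤ℓ)))
        enter rerouted-chain)
    where
    open Detour D
    V : ℕ → Fin (n G)
    V = v P
    tail : ℕ → Fin (n G)
    tail t = V (suc (suc p) + t)

    p≤ℓ : p ≤ suc (suc p) + m
    p≤ℓ = ≤-trans (m≤m+n p m) (m≤n+m (p + m) 2)
    tail-index≤ℓ : ∀ {t} → t < suc m → suc (suc p) + t ≤ suc (suc p) + m
    tail-index≤ℓ t<m = +-monoʳ-≤ (suc (suc p)) (s≤s⁻¹ t<m)
    tail-index≰p+1 : ∀ t → ¬ suc (suc p) + t ≤ suc p
    tail-index≰p+1 t h = 1+n≰n (≤-trans (s≤s (m≤m+n p t)) (s≤s⁻¹ h))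

    prefix-injective : InjectiveBelow p V
    prefix-injective i j i<p j<p =
      path-injective P i j (<-≤-trans i<p p≤ℓ+1) (<-≤-trans j<p p≤ℓ+1)
      where
      p≤ℓ+1 : p ≤ suc (suc (suc p) + m)
      p≤ℓ+1 = m≤n⇒m≤1+n p≤ℓ

    off-tail : ∀ {x} → OffPathOutside P p x → AllBelow (suc m) (x ≢_) tail
    off-tail off t t<m eq = tail-index≰p+1 t (proj₂ (off _ (tail-index≤ℓ t<m) (≡-sym eq)))

    leave-tail : E G x₂ (tail 0)
    leave-tail = subst (E G x₂ ∘ V) (≡-sym (+-identityʳ (suc (suc p)))) leave

    rerouted-chain : Chain (E G) (3 + m) (x₀ ◂ x₁ ◂ x₂ ◂ tail)
    rerouted-chain = ◂-chain {R = E G} x₀x₁ (◂-chain {R = E G} x₁x₂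
      (◂-chain {R = E G} leave-tail (chain-drop {R = E G} (suc (suc p)) (adj P))))

    rerouted-injective : InjectiveBelow (suc (3 + m)) (x₀ ◂ x₁ ◂ x₂ ◂ tail)
    rerouted-injective =
      ◂-injective (◂-all {Q = x₀ ≢_} x₀≢x₁ (◂-all {Q = x₀ ≢_} x₀≢x₂ (off-tail x₀-off)))
        (◂-injective (◂-all {Q = x₁ ≢_} x₁≢x₂ (off-tail x₁-off))
          (◂-injective (off-tail x₂-off)
            (injective-drop (suc (suc p)) (path-injective P))))

    prefix-apart : ∀ a → a < p → AllBelow (suc (3 + m)) (V a ≢_) (x₀ ◂ x₁ ◂ x₂ ◂ tail)
    prefix-apart a a<p =
      ◂-all {Q = V a ≢_} (off-prefix x₀-off)
        (◂-all {Q = V a ≢_} (off-prefix x₁-off) (◂-all {Q = V a ≢_} (off-prefix x₂-off) prefix-tail))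
      where
      a≤ℓ : a ≤ suc (suc p) + m
      a≤ℓ = ≤-trans (<⇒≤ a<p) p≤ℓ
      off-prefix : ∀ {x} → OffPathOutside P p x → V a ≢ x
      off-prefix off eq = <⇒≱ a<p (proj₁ (off a a≤ℓ eq))
      prefix-tail : AllBelow (suc m) (V a ≢_) tail
      prefix-tail t t<m eq = <⇒≱ a<p
        (subst (p ≤_) (≡-sym (inj P a _ a≤ℓ (tail-index≤ℓ t<m) eq)) (≤-trans (m≤m+n p t) (m≤n+m _ 2)))

  detour-path : ∀ {ℓ p} (P : Path G ℓ) → suc (suc p) ≤ ℓ → Detour P p → Path G (suc ℓ)
  detour-path {p = p} P p+2≤ℓ D with m≤n⇒∃[o]m+o≡n p+2≤ℓ
  ... | m , refl =
    subst (Path G) (≡-trans (+-comm p (3 + m)) (cong (3 +_) (+-comm m p))) (detour-path′ P D)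

  successor-distinct : ∀ {ℓ j} (P : Path G ℓ) → suc j ≤ ℓ → v P (suc j) ≢ v P j
  successor-distinct P j+1≤ℓ eq = 1+n≢n (inj P _ _ j+1≤ℓ (<⇒≤ j+1≤ℓ) eq)

  chord-crossing-vee-right : ∀ {ℓ a} (P : Path G ℓ) → 3 + a ≤ ℓ →
    E G (v P a) (v P (2 + a)) → CommonL P (1 + a) (3 + a) → Detour P (suc a)
  chord-crossing-vee-right {ℓ} {a} P 3+a≤ℓ chord (w , (v₁w , w∉P) , (v₃w , _)) = record
    { x₀ = v P (2 + a) ; x₁ = v P (1 + a) ; x₂ = w
    ; x₀-off = segment⇒offPathOutside P (n≤1+n _) ≤-refl 2+a≤ℓ
    ; x₁-off = segment⇒offPathOutside P ≤-refl (n≤1+n _) 1+a≤ℓ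
    ; x₂-off = offPath⇒offPathOutside P w∉P
    ; x₀≢x₁ = successor-distinct P 2+a≤ℓ
    ; x₀≢x₂ = λ eq → w∉P (2 + a , 2+a≤ℓ , eq)
    ; x₁≢x₂ = λ eq → w∉P (1 + a , 1+a≤ℓ , eq)
    ; enter = λ { _ refl → chord }
    ; x₀x₁ = sym G (adj P (1 + a) 2+a≤ℓ)
    ; x₁x₂ = v₁w
    ; leave = sym G v₃w
    }
    where
    2+a≤ℓ : 2 + a ≤ ℓ
    2+a≤ℓ = <⇒≤ 3+a≤ℓ
    1+a≤ℓ : 1 + a ≤ ℓ
    1+a≤ℓ = <⇒≤ 2+a≤ℓ

  chord-crossing-vee-left : ∀ {ℓ a} (P : Path G ℓ) → 3 + a ≤ ℓ →
    E G (v P (1 + a)) (v P (3 + a)) → CommonL P a (2 + a) → Detour P (suc a)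
  chord-crossing-vee-left {ℓ} {a} P 3+a≤ℓ chord (w , (v₀w , _) , (v₂w , w∉P)) = record
    { x₀ = w ; x₁ = v P (2 + a) ; x₂ = v P (1 + a)
    ; x₀-off = offPath⇒offPathOutside P w∉P
    ; x₁-off = segment⇒offPathOutside P (n≤1+n _) ≤-refl 2+a≤ℓ
    ; x₂-off = segment⇒offPathOutside P ≤-refl (n≤1+n _) 1+a≤ℓ
    ; x₀≢x₁ = λ eq → w∉P (2 + a , 2+a≤ℓ , ≡-sym eq)
    ; x₀≢x₂ = λ eq → w∉P (1 + a , 1+a≤ℓ , ≡-sym eq)
    ; x₁≢x₂ = successor-distinct P 2+a≤ℓ
    ; enter = λ { _ refl → v₀w }
    ; x₀x₁ = sym G v₂w
    ; x₁x₂ = sym G (adj P (1 + a) 2+a≤ℓ)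
    ; leave = chord
    }
    where
    2+a≤ℓ : 2 + a ≤ ℓ
    2+a≤ℓ = <⇒≤ 3+a≤ℓ
    1+a≤ℓ : 1 + a ≤ ℓ
    1+a≤ℓ = <⇒≤ 2+a≤ℓ

lemma3p5 : (G : Graph) → Connected G → ¬ HasYSubgraph G →
    (ℓ : ℕ) → (P : Path G ℓ) → Longest P → EndDegMin P → 5 ≤ ℓ →
    (∀ a b → (a ≤ 1) → (ℓ ∸ 1 ≤ b) → b ≤ ℓ → ¬ E G (v P a) (v P b)) →
    ¬ CommonL P 1 (ℓ ∸ 1) →
    (∀ i → 1 ≤ i → i ≤ ℓ ∸ 2 → E G (v P (i ∸ 1)) (v P (suc i)) → ¬ CommonL P i (i + 2))
    × (∀ i → 2 ≤ i → i ≤ ℓ ∸ 1 → E G (v P (i ∸ 1)) (v P (suc i)) → ¬ CommonL P (i ∸ 2) i)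
lemma3p5 G _ _ ℓ P longest _ 5≤ℓ _ _ = vee-right , vee-left
  where
  no-detour : ∀ {p} → suc (suc p) ≤ ℓ → ¬ Detour P p
  no-detour p+2≤ℓ D = 1+n≰n (longest _ (detour-path P p+2≤ℓ D))

  vee-right : ∀ i → 1 ≤ i → i ≤ ℓ ∸ 2 → E G (v P (i ∸ 1)) (v P (suc i)) → ¬ CommonL P i (i + 2)
  vee-right zero ()
  vee-right (suc a) _ i≤ℓ∸2 chord common =
    no-detour 3+a≤ℓ (chord-crossing-vee-right P 3+a≤ℓ chord (subst (CommonL P (suc a)) i+2≡3+a common))
    where
    i+2≡3+a : suc a + 2 ≡ 3 + a
    i+2≡3+a = +-comm (suc a) 2
    3+a≤ℓ : 3 + a ≤ ℓ
    3+a≤ℓ = subst (_≤ ℓ) i+2≡3+a (m≤o∸n⇒m+n≤o (suc a) (≤-trans (s≤s (s≤s z≤n)) 5≤ℓ) i≤ℓ∸2)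

  vee-left : ∀ i → 2 ≤ i → i ≤ ℓ ∸ 1 → E G (v P (i ∸ 1)) (v P (suc i)) → ¬ CommonL P (i ∸ 2) i
  vee-left (suc zero) (s≤s ())
  vee-left (suc (suc a)) _ i≤ℓ∸1 chord common =
    no-detour 3+a≤ℓ (chord-crossing-vee-left P 3+a≤ℓ chord common)
    where
    3+a≤ℓ : 3 + a ≤ ℓ
    3+a≤ℓ = subst (_≤ ℓ) (+-comm (2 + a) 1) (m≤o∸n⇒m+n≤o (2 + a) (≤-trans (s≤s z≤n) 5≤ℓ) i≤ℓ∸1)
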